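{- Let $n\ge 2$, let $t_n$ be the smallest integer $t$ with $\frac1t+\frac1{t+1}+\dots+\frac1{n-1}\le 1$, and for $k\in\{1,\dots,n\}$ let \[r_{k,n}=\frac{t_n-1}{n}\left(\sum_{i=t_n}^{n-k+1}\frac{\binom{n-k}{i-1}}{\binom{n-1}{i-1}}\frac{1}{i-1}+\frac{1}{n-1}\right).\] Then for every $k\in\{1,\dots,n-1\}$ \[r_{k+1,n}=r_{k,n}-\frac{t_n-1}{n}\cdot\frac1k\cdot\frac{\binom{n-t_n+1}{k}}{\binom{n-1}{k}}.\]
   Context: An empty sum is $0$, and $\binom{a}{b}=0$ when $b>a$. (The quantity $r_{k,n}$ is the probability that the optimal secretary algorithm with threshold $t_n$ selects the $k$-th best of $n$ candidates arriving in uniformly random order.) -}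

module Defs where

open import Data.Nat using (ℕ; zero; suc; _∸_; _≤_; _<_)
open import Data.Nat.Combinatorics using (_C_)
open import Data.Integer using (+_)
open import Data.Rational using (ℚ; 0ℚ; 1ℚ; _+_; _*_; _-_) renaming (_/_ to _//_; _≤_ to _≤ℚ_)
open import Relation.Nullary using (¬_)
open import Data.Product using (_×_)

-- a / b as a rational, with the (only formal) convention a / 0 = 0
frac : ℕ → ℕ → ℚ
frac a zero    = 0ℚ
frac a (suc b) = (+ a) // suc b

Σ< : ℕ → (ℕ → ℚ) → ℚ
Σ< zero    f = 0ℚ
Σ< (suc m) f = Σ< m f + f m

-- Σ_{i=a}^{b} f i  (empty, i.e. 0, when a > b)
ΣFT : ℕ → ℕ → (ℕ → ℚ) → ℚ
ΣFT a b f = Σ< (suc b ∸ a) (λ j → f (a Data.Nat.+ j))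

tailH : ℕ → ℕ → ℚ
tailH t n = ΣFT t (n ∸ 1) (λ i → frac 1 i)

IsThreshold : ℕ → ℕ → Set
IsThreshold n t =
  (1 ≤ t) × (tailH t n ≤ℚ 1ℚ) × (∀ s → 1 ≤ s → s < t → ¬ (tailH s n ≤ℚ 1ℚ))

r : ℕ → ℕ → ℕ → ℚ
r t k n =
  frac (t ∸ 1) n *
    (ΣFT t (n ∸ k Data.Nat.+ 1)
          (λ i → frac ((n ∸ k) C (i ∸ 1)) ((n ∸ 1) C (i ∸ 1)) * frac 1 (i ∸ 1))
     + frac 1 (n ∸ 1))

-- Pascal's rule C(n-k,i-1) = C(n-k-1,i-1) + C(n-k-1,i-2) and the identity
-- C(n-k-1,i-2) / ((i-1) C(n-1,i-1)) = C(n-i,k-1) / (k C(n-1,k)) split each summand of r_{k,n}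
-- into the summand of r_{k+1,n} with the same index plus C(n-i,k-1) / (k C(n-1,k)); the one
-- index i = n-k+1 missing from r_{k+1,n} contributes nothing, since C(n-k-1,n-k) = 0. The
-- hockey-stick identity sums the extra terms: Σ_{i=t}^{n-k+1} C(n-i,k-1) = C(n-t+1,k).
-- The threshold is only used to know t_n < n, and for t_n ≤ 1 the prefactor (t_n - 1)/n is 0.
module Submission where

module Binomial where

  open import Data.Nat.Base using (suc; _+_; _*_; _∸_; _≤_; _!; NonZero)
  open import Data.Nat.Properties
  open import Data.Nat.Combinatorics using (_C_; nCk≡n!/k![n-k]!; k![n∸k]!∣n!)
  open import Data.Nat.DivMod using (m/n*n≡m)
  open import Data.Nat.Solver using (module +-*-Solver)
  open +-*-Solver using (solve; _:=_; _:*_)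
  open import Algebra.Properties.CommutativeSemigroup +-commutativeSemigroup using (x∙yz≈y∙xz)
  open import Relation.Binary.PropositionalEquality
  open ≡-Reasoning

  C-*-factorials : ∀ m n {N} → m + n ≡ N → (N C m) * (m ! * n !) ≡ N !
  C-*-factorials m n refl = begin
    ((m + n) C m) * (m ! * n !)            ≡⟨ cong (λ x → ((m + n) C m) * (m ! * x !)) (sym (m+n∸m≡n m n)) ⟩
    ((m + n) C m) * (m ! * (m + n ∸ m) !)  ≡⟨ cong (_* (m ! * (m + n ∸ m) !)) (nCk≡n!/k![n-k]! m≤N) ⟩
    (m + n) ! / _ * (m ! * (m + n ∸ m) !)  ≡⟨ m/n*n≡m (k![n∸k]!∣n! m≤N) ⟩
    (m + n) ! ∎
    where
    open import Data.Nat.Base using (_/_)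
    m≤N = m≤m+n m n
    instance _ = m !* (m + n ∸ m) !≢0

  C-nonZero : ∀ {n k} → k ≤ n → NonZero (n C k)
  C-nonZero {n} {k} k≤n = m*n≢0⇒m≢0 (n C k) {{subst NonZero (sym (C-*-factorials k (n ∸ k) (m+[n∸m]≡n k≤n))) (n !≢0)}}

  suc-*-C-suc : ∀ m n {N} → m + n ≡ N → suc m * (suc N C suc m) ≡ suc N * (N C m)
  suc-*-C-suc m n refl = *-cancelʳ-≡ _ _ (m ! * n !) {{m !* n !≢0}} (begin
    suc m * (suc (m + n) C suc m) * (m ! * n !)  ≡⟨ solve 4 (λ s c f g → s :* c :* (f :* g) := c :* ((s :* f) :* g)) refl (suc m) (suc (m + n) C suc m) (m !) (n !) ⟩
    (suc (m + n) C suc m) * (suc m ! * n !)      ≡⟨ C-*-factorials (suc m) n refl ⟩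
    suc (m + n) !                                ≡⟨ cong (suc (m + n) *_) (sym (C-*-factorials m n refl)) ⟩
    suc (m + n) * (((m + n) C m) * (m ! * n !))  ≡⟨ sym (*-assoc (suc (m + n)) ((m + n) C m) _) ⟩
    suc (m + n) * ((m + n) C m) * (m ! * n !)    ∎)

  C-*-C-comm : ∀ b p c → let A = b + (p + c) in (A C b) * ((p + c) C p) ≡ (A C p) * ((b + c) C b)
  C-*-C-comm b p c = *-cancelʳ-≡ _ _ (b ! * (p ! * c !)) {{m*n≢0 (b !) _ {{b !≢0}} {{p !* c !≢0}}}} (begin
    (A C b) * ((p + c) C p) * (b ! * (p ! * c !))    ≡⟨ solve 5 (λ x z f g h → x :* z :* (f :* (g :* h)) := x :* (f :* (z :* (g :* h)))) refl (A C b) ((p + c) C p) (b !) (p !) (c !) ⟩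
    (A C b) * (b ! * (((p + c) C p) * (p ! * c !)))  ≡⟨ cong (λ x → (A C b) * (b ! * x)) (C-*-factorials p c refl) ⟩
    (A C b) * (b ! * (p + c) !)                      ≡⟨ C-*-factorials b (p + c) refl ⟩
    A !                                              ≡⟨ sym (C-*-factorials p (b + c) (x∙yz≈y∙xz p b c)) ⟩
    (A C p) * (p ! * (b + c) !)                      ≡⟨ cong (λ x → (A C p) * (p ! * x)) (sym (C-*-factorials b c refl)) ⟩
    (A C p) * (p ! * (((b + c) C b) * (b ! * c !)))  ≡⟨ solve 5 (λ y e f g h → y :* (g :* (e :* (f :* h))) := y :* e :* (f :* (g :* h))) refl (A C p) ((b + c) C b) (b !) (p !) (c !) ⟩
    (A C p) * ((b + c) C b) * (b ! * (p ! * c !))    ∎)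
    where A = b + (p + c)

  -- C(p+c,p) / ((p+1) C(A+1,p+1)) is symmetric in b and p.
  C-ratio-sym : ∀ b p c → let A = b + (p + c) in
           ((p + c) C p) * (suc b * (suc A C suc b)) ≡ ((b + c) C b) * ((suc A C suc p) * suc p)
  C-ratio-sym b p c = begin
    Z * (suc b * (suc A C suc b))  ≡⟨ cong (Z *_) (suc-*-C-suc b (p + c) refl) ⟩
    Z * (suc A * (A C b))          ≡⟨ solve 3 (λ z s x → z :* (s :* x) := s :* (x :* z)) refl Z (suc A) (A C b) ⟩
    suc A * ((A C b) * Z)          ≡⟨ cong (suc A *_) (C-*-C-comm b p c) ⟩
    suc A * ((A C p) * E)          ≡⟨ solve 3 (λ e s y → s :* (y :* e) := e :* (s :* y)) refl E (suc A) (A C p) ⟩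
    E * (suc A * (A C p))          ≡⟨ cong (E *_) (sym (suc-*-C-suc p (b + c) (x∙yz≈y∙xz p b c))) ⟩
    E * (suc p * (suc A C suc p))  ≡⟨ cong (E *_) (*-comm (suc p) _) ⟩
    E * ((suc A C suc p) * suc p)  ∎
    where
    A = b + (p + c)
    Z = (p + c) C p
    E = (b + c) C b

open import Defs
open import Data.Nat.Base as ℕ using (ℕ; zero; suc; _∸_; _≤_; _<_; z≤n; s≤s; NonZero)
import Data.Nat.Properties as ℕ
open import Data.Nat.Combinatorics using (_C_; nCk+nC[k+1]≡[n+1]C[k+1]; k>n⇒nCk≡0)
open import Data.Nat.Solver using () renaming (module +-*-Solver to ℕ-Solver)
open import Data.Integer.Base using (+_)
import Data.Integer.Base as ℤ
import Data.Integer.Properties as ℤ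
open import Data.Rational.Base using (ℚ; 0ℚ; 1ℚ; _+_; _*_; _-_; toℚᵘ) renaming (_≤_ to _≤ℚ_)
import Data.Rational.Properties as ℚ
open import Data.Rational.Properties using (toℚᵘ-injective; toℚᵘ-fromℚᵘ; toℚᵘ-homo-*; toℚᵘ-homo-+; fromℚᵘ-cong; toℚᵘ-cancel-≤)
open import Data.Rational.Solver using () renaming (module +-*-Solver to ℚ-Solver)
open import Data.Rational.Unnormalised.Base as ℚᵘ using (mkℚᵘ; *≡*; *≤*; _≃_)
import Data.Rational.Unnormalised.Properties as ℚᵘ
open import Data.Product.Base using (_,_)
open import Data.Empty using (⊥-elim)
open import Relation.Nullary using (yes; no)
open import Relation.Binary.PropositionalEquality
open import Algebra.Properties.CommutativeSemigroup ℕ.+-commutativeSemigroup using () renaming (x∙yz≈y∙xz to +-x∙yz≈y∙xz)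

open Binomial

private
  toℚᵘ-frac : ∀ a b → toℚᵘ (frac a (suc b)) ≃ mkℚᵘ (+ a) b
  toℚᵘ-frac a b = toℚᵘ-fromℚᵘ (mkℚᵘ (+ a) b)

frac-cross : ∀ a b c d .{{_ : NonZero b}} .{{_ : NonZero d}} → a ℕ.* d ≡ c ℕ.* b → frac a b ≡ frac c d
frac-cross a (suc b) c (suc d) eq = fromℚᵘ-cong {mkℚᵘ (+ a) b} {mkℚᵘ (+ c) d} (*≡* (begin
  + a ℤ.* + suc d    ≡⟨ ℤ.pos-* a (suc d) ⟨
  + (a ℕ.* suc d)    ≡⟨ cong +_ eq ⟩
  + (c ℕ.* suc b)    ≡⟨ ℤ.pos-* c (suc b) ⟩
  + c ℤ.* + suc b    ∎))
  where open ≡-Reasoning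

frac-* : ∀ a b c d → frac a b * frac c d ≡ frac (a ℕ.* c) (b ℕ.* d)
frac-* a zero    c d       = ℚ.*-zeroˡ (frac c d)
frac-* a (suc b) c zero    = trans (ℚ.*-zeroʳ (frac a (suc b))) (cong (frac (a ℕ.* c)) (sym (ℕ.*-zeroʳ b)))
frac-* a (suc b) c (suc d) = toℚᵘ-injective (begin
  toℚᵘ (frac a (suc b) * frac c (suc d))                 ≈⟨ toℚᵘ-homo-* (frac a (suc b)) (frac c (suc d)) ⟩
  toℚᵘ (frac a (suc b)) ℚᵘ.* toℚᵘ (frac c (suc d))       ≈⟨ ℚᵘ.*-cong (toℚᵘ-frac a b) (toℚᵘ-frac c d) ⟩
  mkℚᵘ (+ a) b ℚᵘ.* mkℚᵘ (+ c) d                         ≈⟨ *≡* (cong (ℤ._* + suc (d ℕ.+ b ℕ.* suc d)) (sym (ℤ.pos-* a c))) ⟩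
  mkℚᵘ (+ (a ℕ.* c)) (d ℕ.+ b ℕ.* suc d)                 ≈⟨ ℚᵘ.≃-sym (toℚᵘ-frac (a ℕ.* c) _) ⟩
  toℚᵘ (frac (a ℕ.* c) (suc b ℕ.* suc d))                ∎)
  where open ℚᵘ.≃-Reasoning

frac-+ : ∀ a b c d .{{_ : NonZero b}} .{{_ : NonZero d}} →
         frac a b + frac c d ≡ frac (a ℕ.* d ℕ.+ c ℕ.* b) (b ℕ.* d)
frac-+ a (suc b) c (suc d) = toℚᵘ-injective (begin
  toℚᵘ (frac a (suc b) + frac c (suc d))                 ≈⟨ toℚᵘ-homo-+ (frac a (suc b)) (frac c (suc d)) ⟩
  toℚᵘ (frac a (suc b)) ℚᵘ.+ toℚᵘ (frac c (suc d))       ≈⟨ ℚᵘ.+-cong (toℚᵘ-frac a b) (toℚᵘ-frac c d) ⟩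
  mkℚᵘ (+ a) b ℚᵘ.+ mkℚᵘ (+ c) d                         ≈⟨ *≡* (cong (ℤ._* + suc (d ℕ.+ b ℕ.* suc d)) numerator) ⟩
  mkℚᵘ (+ (a ℕ.* suc d ℕ.+ c ℕ.* suc b)) (d ℕ.+ b ℕ.* suc d)  ≈⟨ ℚᵘ.≃-sym (toℚᵘ-frac _ _) ⟩
  toℚᵘ (frac (a ℕ.* suc d ℕ.+ c ℕ.* suc b) (suc b ℕ.* suc d))  ∎)
  where
  open ℚᵘ.≃-Reasoning
  numerator : + a ℤ.* + suc d ℤ.+ + c ℤ.* + suc b ≡ + (a ℕ.* suc d ℕ.+ c ℕ.* suc b)
  numerator = trans (cong₂ ℤ._+_ (sym (ℤ.pos-* a (suc d))) (sym (ℤ.pos-* c (suc b))))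
                    (sym (ℤ.pos-+ (a ℕ.* suc d) (c ℕ.* suc b)))

frac-0 : ∀ b → frac 0 b ≡ 0ℚ
frac-0 zero    = refl
frac-0 (suc b) = frac-cross 0 (suc b) 0 1 refl

frac-1≤1 : ∀ b → frac 1 b ≤ℚ 1ℚ
frac-1≤1 zero    = toℚᵘ-cancel-≤ (*≤* (ℤ.+≤+ ℕ.z≤n))
frac-1≤1 (suc b) = toℚᵘ-cancel-≤ (ℚᵘ.≤-respˡ-≃ (ℚᵘ.≃-sym (toℚᵘ-frac 1 b)) (*≤* (ℤ.+≤+ (ℕ.s≤s ℕ.z≤n))))

frac-+-1 : ∀ x y → frac x 1 + frac y 1 ≡ frac (x ℕ.+ y) 1
frac-+-1 x y = trans (frac-+ x 1 y 1) (cong (λ z → frac z 1) (cong₂ ℕ._+_ (ℕ.*-identityʳ x) (ℕ.*-identityʳ y)))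

frac-split : ∀ {X Y Z E B I K} .{{_ : NonZero B}} .{{_ : NonZero I}} .{{_ : NonZero K}} →
             X ≡ Z ℕ.+ Y → Z ℕ.* K ≡ E ℕ.* (B ℕ.* I) →
             frac X B * frac 1 I ≡ frac Y B * frac 1 I + frac E 1 * frac 1 K
frac-split {X} {Y} {Z} {E} {B} {I} {K} refl ZK≡EBI = begin
  frac X B * frac 1 I                                         ≡⟨ frac-* X B 1 I ⟩
  frac (X ℕ.* 1) W                                            ≡⟨ frac-cross (X ℕ.* 1) W _ (W ℕ.* (1 ℕ.* K)) cross ⟩
  frac (Y ℕ.* 1 ℕ.* (1 ℕ.* K) ℕ.+ E ℕ.* 1 ℕ.* W) (W ℕ.* (1 ℕ.* K))  ≡⟨ frac-+ (Y ℕ.* 1) W (E ℕ.* 1) (1 ℕ.* K) ⟨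
  frac (Y ℕ.* 1) W + frac (E ℕ.* 1) (1 ℕ.* K)                 ≡⟨ cong₂ _+_ (frac-* Y B 1 I) (frac-* E 1 1 K) ⟨
  frac Y B * frac 1 I + frac E 1 * frac 1 K                   ∎
  where
  open ≡-Reasoning
  open ℕ-Solver using (solve; _:=_; _:+_; _:*_; con)
  W = B ℕ.* I
  instance
    _ = ℕ.m*n≢0 B I
    _ = ℕ.m*n≢0 1 K
    _ = ℕ.m*n≢0 W (1 ℕ.* K)
  cross : X ℕ.* 1 ℕ.* (W ℕ.* (1 ℕ.* K)) ≡ (Y ℕ.* 1 ℕ.* (1 ℕ.* K) ℕ.+ E ℕ.* 1 ℕ.* W) ℕ.* W
  cross = begin
    (Z ℕ.+ Y) ℕ.* 1 ℕ.* (W ℕ.* (1 ℕ.* K))  ≡⟨ solve 4 (λ z y w k → (z :+ y) :* con 1 :* (w :* (con 1 :* k)) := z :* k :* w :+ y :* k :* w) refl Z Y W K ⟩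
    Z ℕ.* K ℕ.* W ℕ.+ Y ℕ.* K ℕ.* W        ≡⟨ cong (λ x → x ℕ.* W ℕ.+ Y ℕ.* K ℕ.* W) ZK≡EBI ⟩
    E ℕ.* W ℕ.* W ℕ.+ Y ℕ.* K ℕ.* W        ≡⟨ solve 4 (λ e y w k → e :* w :* w :+ y :* k :* w := (y :* con 1 :* (con 1 :* k) :+ e :* con 1 :* w) :* w) refl E Y W K ⟩
    (Y ℕ.* 1 ℕ.* (1 ℕ.* K) ℕ.+ E ℕ.* 1 ℕ.* W) ℕ.* W  ∎

Σ<-cong : ∀ N {f g} → (∀ j → j ℕ.< N → f j ≡ g j) → Σ< N f ≡ Σ< N g
Σ<-cong zero    f≗g = refl
Σ<-cong (suc N) f≗g = cong₂ _+_ (Σ<-cong N (λ j j<N → f≗g j (ℕ.m<n⇒m<1+n j<N))) (f≗g N ℕ.≤-refl)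

Σ<-+ : ∀ N f g → Σ< N (λ j → f j + g j) ≡ Σ< N f + Σ< N g
Σ<-+ zero    f g = sym (ℚ.+-identityˡ 0ℚ)
Σ<-+ (suc N) f g = trans (cong (_+ (f N + g N)) (Σ<-+ N f g))
  (solve 4 (λ a b c d → (a :+ b) :+ (c :+ d) := (a :+ c) :+ (b :+ d)) refl (Σ< N f) (Σ< N g) (f N) (g N))
  where open ℚ-Solver using (solve; _:=_; _:+_)

Σ<-*ʳ : ∀ N f q → Σ< N (λ j → f j * q) ≡ Σ< N f * q
Σ<-*ʳ zero    f q = sym (ℚ.*-zeroˡ q)
Σ<-*ʳ (suc N) f q = trans (cong (_+ (f N * q)) (Σ<-*ʳ N f q)) (sym (ℚ.*-distribʳ-+ q (Σ< N f) (f N)))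

ΣFT-count : ∀ a {b} m f → a ℕ.+ m ≡ suc b → ΣFT a b f ≡ Σ< m (λ j → f (a ℕ.+ j))
ΣFT-count a m f a+m≡1+b = cong (λ N → Σ< N (λ j → f (a ℕ.+ j))) (trans (cong (ℕ._∸ a) (sym a+m≡1+b)) (ℕ.m+n∸m≡n a m))

ΣFT-empty : ∀ {a b} f → b ℕ.< a → ΣFT a b f ≡ 0ℚ
ΣFT-empty {a} f b<a = cong (λ N → Σ< N (λ j → f (a ℕ.+ j))) (ℕ.m≤n⇒m∸n≡0 b<a)

Σ<-hockey-stick : ∀ L b N → N ℕ.≤ suc L →
                  Σ< N (λ j → frac ((L ℕ.∸ j) C b) 1) + frac ((suc L ℕ.∸ N) C suc b) 1 ≡ frac (suc L C suc b) 1
Σ<-hockey-stick L b zero    _           = ℚ.+-identityˡ _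
Σ<-hockey-stick L b (suc N) (ℕ.s≤s N≤L) = begin
  (Σ< N g + g N) + frac ((L ℕ.∸ N) C suc b) 1                ≡⟨ ℚ.+-assoc (Σ< N g) (g N) _ ⟩
  Σ< N g + (g N + frac ((L ℕ.∸ N) C suc b) 1)                ≡⟨ cong (λ x → Σ< N g + x) (frac-+-1 ((L ℕ.∸ N) C b) ((L ℕ.∸ N) C suc b)) ⟩
  Σ< N g + frac ((L ℕ.∸ N) C b ℕ.+ (L ℕ.∸ N) C suc b) 1       ≡⟨ cong (λ x → Σ< N g + frac x 1) (nCk+nC[k+1]≡[n+1]C[k+1] (L ℕ.∸ N) b) ⟩
  Σ< N g + frac (suc (L ℕ.∸ N) C suc b) 1                    ≡⟨ cong (λ x → Σ< N g + frac (x C suc b) 1) (ℕ.+-∸-assoc 1 N≤L) ⟨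
  Σ< N g + frac ((suc L ℕ.∸ N) C suc b) 1                    ≡⟨ Σ<-hockey-stick L b N (ℕ.m≤n⇒m≤1+n N≤L) ⟩
  frac (suc L C suc b) 1                                     ∎
  where
  open ≡-Reasoning
  g = λ j → frac ((L ℕ.∸ j) C b) 1

x/1*1/[a*d]≡1/a*x/d : ∀ x a d .{{_ : NonZero a}} .{{_ : NonZero d}} →
                      frac x 1 * frac 1 (a ℕ.* d) ≡ frac 1 a * frac x d
x/1*1/[a*d]≡1/a*x/d x a d = begin
  frac x 1 * frac 1 (a ℕ.* d)       ≡⟨ frac-* x 1 1 (a ℕ.* d) ⟩
  frac (x ℕ.* 1) (1 ℕ.* (a ℕ.* d))  ≡⟨ frac-cross _ (1 ℕ.* (a ℕ.* d)) _ (a ℕ.* d) (solve 3 (λ x a d → x :* con 1 :* (a :* d) := con 1 :* x :* (con 1 :* (a :* d))) refl x a d) ⟩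
  frac (1 ℕ.* x) (a ℕ.* d)          ≡⟨ frac-* 1 a x d ⟨
  frac 1 a * frac x d               ∎
  where
  open ≡-Reasoning
  open ℕ-Solver using (solve; _:=_; _:*_; con)
  instance
    _ = ℕ.m*n≢0 a d
    _ = ℕ.m*n≢0 1 (a ℕ.* d)


m+[n+o]∸n≡m+o : ∀ m n o → m ℕ.+ (n ℕ.+ o) ∸ n ≡ m ℕ.+ o
m+[n+o]∸n≡m+o m n o = trans (cong (_∸ n) (+-x∙yz≈y∙xz m n o)) (ℕ.m+n∸m≡n n (m ℕ.+ o))

summand : ℕ → ℕ → ℕ → ℚ
summand k n i = frac ((n ∸ k) C (i ∸ 1)) ((n ∸ 1) C (i ∸ 1)) * frac 1 (i ∸ 1)

r-sum : ℕ → ℕ → ℕ → ℚ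
r-sum t k n = ΣFT t (n ∸ k ℕ.+ 1) (summand k n)

binomial-summand-split : ∀ b p c → let A = b ℕ.+ (p ℕ.+ c) in
  frac (suc (p ℕ.+ c) C suc p) (suc A C suc p) * frac 1 (suc p)
    ≡ frac ((p ℕ.+ c) C suc p) (suc A C suc p) * frac 1 (suc p)
      + frac ((b ℕ.+ c) C b) 1 * frac 1 (suc b ℕ.* (suc A C suc b))
binomial-summand-split b p c =
  frac-split {Z = (p ℕ.+ c) C p} {E = (b ℕ.+ c) C b} {B = suc A C suc p} {I = suc p} {K = suc b ℕ.* (suc A C suc b)}
             (sym (nCk+nC[k+1]≡[n+1]C[k+1] (p ℕ.+ c) p)) (C-ratio-sym b p c)
  where
  A = b ℕ.+ (p ℕ.+ c)
  instance
    _ = C-nonZero {suc A} {suc p} (s≤s (ℕ.≤-trans (ℕ.m≤m+n p c) (ℕ.m≤n+m (p ℕ.+ c) b)))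
    _ = ℕ.m*n≢0 (suc b) (suc A C suc b) {{_}} {{C-nonZero (s≤s (ℕ.m≤m+n b (p ℕ.+ c)))}}

summand-at : ∀ k n {x y} p → n ∸ k ≡ x → n ∸ 1 ≡ y →
             summand k n (suc p) ≡ frac (x C p) (y C p) * frac 1 p
summand-at k n p n∸k≡x n∸1≡y = cong₂ (λ x y → frac (x C p) (y C p) * frac 1 p) n∸k≡x n∸1≡y

summand-split : ∀ t₀ b m j → j ≤ m → let n = suc (suc (t₀ ℕ.+ (b ℕ.+ m))) in
  summand (suc b) n (suc (suc (t₀ ℕ.+ j)))
    ≡ summand (suc (suc b)) n (suc (suc (t₀ ℕ.+ j)))
      + frac ((b ℕ.+ m ∸ j) C b) 1 * frac 1 (suc b ℕ.* ((n ∸ 1) C suc b))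
summand-split t₀ b m j j≤m with ℕ.m≤n⇒∃[o]m+o≡n j≤m
... | c , refl = begin
  summand (suc b) n (suc (suc p))
    ≡⟨ summand-at (suc b) n (suc p) (trans (m+[n+o]∸n≡m+o (suc t₀) b (j ℕ.+ c)) (cong suc p+c)) n∸1 ⟩
  frac (suc (p ℕ.+ c) C suc p) (suc A C suc p) * frac 1 (suc p)
    ≡⟨ binomial-summand-split b p c ⟩
  frac ((p ℕ.+ c) C suc p) (suc A C suc p) * frac 1 (suc p) + frac ((b ℕ.+ c) C b) 1 * frac 1 (suc b ℕ.* (suc A C suc b))
    ≡⟨ cong₂ _+_ (summand-at (suc (suc b)) n (suc p) (trans (m+[n+o]∸n≡m+o t₀ b (j ℕ.+ c)) p+c) n∸1)
                 (cong₂ (λ x y → frac (x C b) 1 * frac 1 (suc b ℕ.* (y C suc b))) (m+[n+o]∸n≡m+o b j c) n∸1) ⟨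
  summand (suc (suc b)) n (suc (suc p)) + frac ((b ℕ.+ (j ℕ.+ c) ∸ j) C b) 1 * frac 1 (suc b ℕ.* ((n ∸ 1) C suc b))
    ∎
  where
  open ≡-Reasoning
  n = suc (suc (t₀ ℕ.+ (b ℕ.+ (j ℕ.+ c))))
  p = t₀ ℕ.+ j
  A = b ℕ.+ (p ℕ.+ c)
  p+c : t₀ ℕ.+ (j ℕ.+ c) ≡ p ℕ.+ c
  p+c = sym (ℕ.+-assoc t₀ j c)
  n∸1 : n ∸ 1 ≡ suc A
  n∸1 = cong suc (trans (+-x∙yz≈y∙xz t₀ b (j ℕ.+ c)) (cong (b ℕ.+_) p+c))

r-sum-step-nonempty : ∀ t₀ b m → let t = suc (suc t₀) ; n = suc (suc (t₀ ℕ.+ (b ℕ.+ m))) in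
  r-sum t (suc b) n ≡ r-sum t (suc (suc b)) n + frac 1 (suc b) * frac (suc (n ∸ t) C suc b) ((n ∸ 1) C suc b)
r-sum-step-nonempty t₀ b m = begin
  r-sum t k n
    ≡⟨ ΣFT-count t (suc m) (summand k n) count-k ⟩
  Σ< (suc m) (λ j → summand k n (t ℕ.+ j))
    ≡⟨ Σ<-cong (suc m) (λ j j<1+m → summand-split t₀ b m j (ℕ.s≤s⁻¹ j<1+m)) ⟩
  Σ< (suc m) (λ j → summand (suc k) n (t ℕ.+ j) + g j * q)
    ≡⟨ Σ<-+ (suc m) (λ j → summand (suc k) n (t ℕ.+ j)) (λ j → g j * q) ⟩
  Σ< (suc m) (λ j → summand (suc k) n (t ℕ.+ j)) + Σ< (suc m) (λ j → g j * q)
    ≡⟨ cong₂ _+_ (cong (λ x → Σ< m (λ j → summand (suc k) n (t ℕ.+ j)) + x) last-summand≡0) (Σ<-*ʳ (suc m) g q) ⟩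
  (Σ< m (λ j → summand (suc k) n (t ℕ.+ j)) + 0ℚ) + Σ< (suc m) g * q
    ≡⟨ cong₂ _+_ (trans (ℚ.+-identityʳ _) (sym (ΣFT-count t m (summand (suc k) n) count-suc-k))) (cong (_* q) Σg) ⟩
  r-sum t (suc k) n + frac (suc (b ℕ.+ m) C suc b) 1 * q
    ≡⟨ cong (λ x → r-sum t (suc k) n + x) (trans (x/1*1/[a*d]≡1/a*x/d _ k D) (cong (λ x → frac 1 k * frac (suc x C k) D) (sym (ℕ.m+n∸m≡n t₀ (b ℕ.+ m))))) ⟩
  r-sum t (suc k) n + frac 1 k * frac (suc (n ∸ t) C k) D
    ∎
  where
  open ≡-Reasoning
  t = suc (suc t₀)
  n = suc (suc (t₀ ℕ.+ (b ℕ.+ m)))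
  k = suc b
  D = (n ∸ 1) C k
  instance _ = C-nonZero {n ∸ 1} {k} (s≤s (ℕ.≤-trans (ℕ.m≤m+n b m) (ℕ.m≤n+m (b ℕ.+ m) t₀)))
  g = λ j → frac ((b ℕ.+ m ∸ j) C b) 1
  q = frac 1 (k ℕ.* D)
  count-k : t ℕ.+ suc m ≡ suc (n ∸ k ℕ.+ 1)
  count-k = trans (solve 2 (λ t₀ m → con 2 :+ (t₀ :+ (con 1 :+ m)) := con 1 :+ ((con 1 :+ (t₀ :+ m)) :+ con 1)) refl t₀ m)
                  (cong (λ x → suc (x ℕ.+ 1)) (sym (m+[n+o]∸n≡m+o (suc t₀) b m)))
    where open ℕ-Solver
  count-suc-k : t ℕ.+ m ≡ suc (n ∸ suc k ℕ.+ 1)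
  count-suc-k = trans (solve 2 (λ t₀ m → con 2 :+ (t₀ :+ m) := con 1 :+ ((t₀ :+ m) :+ con 1)) refl t₀ m)
                      (cong (λ x → suc (x ℕ.+ 1)) (sym (m+[n+o]∸n≡m+o t₀ b m)))
    where open ℕ-Solver
  last-summand≡0 : summand (suc k) n (t ℕ.+ m) ≡ 0ℚ
  last-summand≡0 = begin
    summand (suc k) n (suc (suc (t₀ ℕ.+ m)))
      ≡⟨ summand-at (suc k) n (suc (t₀ ℕ.+ m)) (m+[n+o]∸n≡m+o t₀ b m) refl ⟩
    frac ((t₀ ℕ.+ m) C suc (t₀ ℕ.+ m)) ((n ∸ 1) C suc (t₀ ℕ.+ m)) * frac 1 (suc (t₀ ℕ.+ m))
      ≡⟨ cong (λ x → frac x ((n ∸ 1) C suc (t₀ ℕ.+ m)) * frac 1 (suc (t₀ ℕ.+ m))) (k>n⇒nCk≡0 (ℕ.n<1+n (t₀ ℕ.+ m))) ⟩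
    frac 0 ((n ∸ 1) C suc (t₀ ℕ.+ m)) * frac 1 (suc (t₀ ℕ.+ m))
      ≡⟨ cong (_* frac 1 (suc (t₀ ℕ.+ m))) (frac-0 ((n ∸ 1) C suc (t₀ ℕ.+ m))) ⟩
    0ℚ * frac 1 (suc (t₀ ℕ.+ m))
      ≡⟨ ℚ.*-zeroˡ (frac 1 (suc (t₀ ℕ.+ m))) ⟩
    0ℚ ∎
  Σg : Σ< (suc m) g ≡ frac (suc (b ℕ.+ m) C suc b) 1
  Σg = begin
    Σ< (suc m) g                                               ≡⟨ ℚ.+-identityʳ _ ⟨
    Σ< (suc m) g + 0ℚ                                          ≡⟨ cong (λ x → Σ< (suc m) g + x) remainder≡0 ⟨
    Σ< (suc m) g + frac ((suc (b ℕ.+ m) ∸ suc m) C suc b) 1    ≡⟨ Σ<-hockey-stick (b ℕ.+ m) b (suc m) (s≤s (ℕ.m≤n+m m b)) ⟩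
    frac (suc (b ℕ.+ m) C suc b) 1                             ∎
    where
    remainder≡0 : frac ((b ℕ.+ m ∸ m) C suc b) 1 ≡ 0ℚ
    remainder≡0 = trans (cong (λ x → frac (x C suc b) 1) (ℕ.m+n∸n≡m b m))
                        (trans (cong (λ x → frac x 1) (k>n⇒nCk≡0 (ℕ.n<1+n b))) (frac-0 1))

r-sum-step-empty : ∀ t₀ b d → d < b → let t = suc (suc t₀) ; n = suc (suc (t₀ ℕ.+ d)) in
  r-sum t (suc b) n ≡ r-sum t (suc (suc b)) n + frac 1 (suc b) * frac (suc (n ∸ t) C suc b) ((n ∸ 1) C suc b)
r-sum-step-empty t₀ b d d<b = begin
  r-sum t k n                                                 ≡⟨ ΣFT-empty (summand k n) (bound<t n∸k≤t₀) ⟩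
  0ℚ                                                          ≡⟨ ℚ.+-identityʳ 0ℚ ⟨
  0ℚ + 0ℚ                                                     ≡⟨ cong₂ _+_ (ΣFT-empty (summand (suc k) n) (bound<t n∸1+k≤t₀)) correction≡0 ⟨
  r-sum t (suc k) n + frac 1 k * frac (suc (n ∸ t) C k) D     ∎
  where
  open ≡-Reasoning
  t = suc (suc t₀)
  n = suc (suc (t₀ ℕ.+ d))
  k = suc b
  D = (n ∸ 1) C k
  bound<t : ∀ {x} → x ≤ t₀ → x ℕ.+ 1 < t
  bound<t {x} x≤t₀ = subst (_< t) (ℕ.+-comm 1 x) (s≤s (s≤s x≤t₀))
  n∸k≤t₀ : n ∸ k ≤ t₀
  n∸k≤t₀ = ℕ.m≤n+o⇒m∸n≤o (suc (t₀ ℕ.+ d)) b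
             (subst₂ _≤_ (ℕ.+-suc t₀ d) (ℕ.+-comm t₀ b) (ℕ.+-monoʳ-≤ t₀ d<b))
  n∸1+k≤t₀ : n ∸ suc k ≤ t₀
  n∸1+k≤t₀ = ℕ.≤-trans (ℕ.∸-monoʳ-≤ n (ℕ.n≤1+n k)) n∸k≤t₀
  correction≡0 : frac 1 k * frac (suc (n ∸ t) C k) D ≡ 0ℚ
  correction≡0 = begin
    frac 1 k * frac (suc (n ∸ t) C k) D  ≡⟨ cong (λ x → frac 1 k * frac (suc x C k) D) (ℕ.m+n∸m≡n t₀ d) ⟩
    frac 1 k * frac (suc d C k) D        ≡⟨ cong (λ x → frac 1 k * frac x D) (k>n⇒nCk≡0 (s≤s d<b)) ⟩
    frac 1 k * frac 0 D                  ≡⟨ cong (frac 1 k *_) (frac-0 D) ⟩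
    frac 1 k * 0ℚ                        ≡⟨ ℚ.*-zeroʳ (frac 1 k) ⟩
    0ℚ                                   ∎

-- t ≤ n is needed because suc (n ∸ t) truncates.
r-sum-step : ∀ {t n} k → 2 ≤ t → t ≤ n → 1 ≤ k →
  r-sum t k n ≡ r-sum t (suc k) n + frac 1 k * frac (suc (n ∸ t) C k) ((n ∸ 1) C k)
r-sum-step {suc zero}     _       (s≤s ()) _ _
r-sum-step {suc (suc t₀)} (suc b) _ t≤n _ with ℕ.m≤n⇒∃[o]m+o≡n t≤n
... | d , refl with b ℕ.≤? d
...   | no b≰d = r-sum-step-empty t₀ b d (ℕ.≰⇒> b≰d)
...   | yes b≤d with ℕ.m≤n⇒∃[o]m+o≡n b≤d
...     | m , refl = r-sum-step-nonempty t₀ b m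

tailH-last≤1 : ∀ a → tailH (suc a) (suc (suc a)) ≤ℚ 1ℚ
tailH-last≤1 a = subst (_≤ℚ 1ℚ) single-term (frac-1≤1 (suc a ℕ.+ 0))
  where
  single-term : frac 1 (suc a ℕ.+ 0) ≡ tailH (suc a) (suc (suc a))
  single-term = trans (sym (ℚ.+-identityˡ _)) (sym (ΣFT-count (suc a) 1 (frac 1) (ℕ.+-comm (suc a) 1)))

threshold-< : ∀ {n t} → 2 ≤ n → IsThreshold n t → t < n
threshold-< {suc zero}    (s≤s ())
threshold-< {suc (suc a)} {t} _ (_ , _ , minimal) with t ℕ.<? suc (suc a)
... | yes t<n = t<n
... | no  t≮n = ⊥-elim (minimal (suc a) (s≤s z≤n) (ℕ.≮⇒≥ t≮n) (tailH-last≤1 a))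

private
  factor≡0 : ∀ {c A B x y} → c ≡ 0ℚ → c * A ≡ c * B - c * x * y
  factor≡0 {A = A} {B} {x} {y} refl = solve 4 (λ a b x y → con 0ℚ :* a := con 0ℚ :* b :- con 0ℚ :* x :* y) refl A B x y
    where open ℚ-Solver

lemma3 : ∀ (n t : ℕ) → 2 ≤ n → IsThreshold n t →
         ∀ (k : ℕ) → 1 ≤ k → k ≤ n ∸ 1 →
         r t (suc k) n ≡
           r t k n - frac (t ∸ 1) n * frac 1 k * frac ((suc (n ∸ t)) C k) ((n ∸ 1) C k)
lemma3 n zero            _   _  _ _   _ = factor≡0 (frac-0 n)
lemma3 n (suc zero)      _   _  _ _   _ = factor≡0 (frac-0 n)
lemma3 n t@(suc (suc _)) 2≤n th k 1≤k _ =
  subtract {frac (t ∸ 1) n} {S′ = r-sum t (suc k) n} {h = frac 1 (n ∸ 1)}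
           (r-sum-step k (s≤s (s≤s z≤n)) (ℕ.<⇒≤ (threshold-< 2≤n th)) 1≤k)
  where
  subtract : ∀ {c S S′ h x y} → S ≡ S′ + x * y → c * (S′ + h) ≡ c * (S + h) - c * x * y
  subtract {c} {S′ = S′} {h} {x} {y} refl = solve 5 (λ c s h x y → c :* (s :+ h) := c :* ((s :+ x :* y) :+ h) :- c :* x :* y) refl c S′ h x y
    where open ℚ-Solver
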